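{- Let $r\ge 2$ and $s\ge 1$ be fixed integers and let $F$ be a fixed $r$-graph with at least one hyperedge. If $F$ has no vertex that is contained in every hyperedge of $F$, then $\mathrm{ex}_r(n,\{F,M_{s+1}^r\})=\Theta(n^{r-1})$ as $n\to\infty$. Otherwise, let $F'$ be the link $(r-1)$-graph of a vertex of $F$ that is contained in every hyperedge of $F$; then $\mathrm{ex}_r(n,\{F,M_{s+1}^r\})=\Theta(\mathrm{ex}_{r-1}(n,F'))$ as $n\to\infty$.
   Context: An $r$-graph is a hypergraph all of whose hyperedges have exactly $r$ vertices. $M_{s+1}^r$ denotes the $r$-graph consisting of $s+1$ pairwise disjoint hyperedges. For a family $\mathcal{F}$ of $r$-graphs, $\mathrm{ex}_r(n,\mathcal{F})$ is the maximum number of hyperedges in an $n$-vertex $r$-graph containing no member of $\mathcal{F}$ as a subhypergraph. The link hypergraph of a vertex $v$ of an $r$-graph $F$ is the $(r-1)$-graph whose hyperedges are the $(r-1)$-sets $e$ such that $e\cup\{v\}$ is a hyperedge of $F$. The implied constants in $\Theta$ may depend on $F$, $r$ and $s$. -}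

module Defs where

open import Data.Bool using (Bool; true; false; if_then_else_; _∧_; not)
import Data.Bool.Properties as BoolP
open import Data.Nat using (ℕ; zero; suc; _+_; _*_; _∸_; _^_; _≤_)
open import Data.Fin using (Fin; zero; suc; remQuot)
import Data.Fin.Properties as FinP
open import Data.Fin.Subset using (Subset; ⊥; ⁅_⁆; _∪_; ∣_∣; inside; outside)
open import Data.Vec using (Vec; []; _∷_; lookup; tabulate)
import Data.Vec.Properties as VecP
open import Data.List using (List; []; _∷_; map; _++_)
open import Data.Nat.ListAction using (sum)
open import Data.Product using (Σ; ∃; ∃-syntax; _×_; _,_; proj₁)
open import Function.Definitions using (Injective)
open import Relation.Nullary using (¬_)
open import Relation.Nullary.Decidable using (⌊_⌋)
open import Relation.Binary.PropositionalEquality using (_≡_)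

Hypergraph : ℕ → Set
Hypergraph n = Subset n → Bool

Uniform : ℕ → {n : ℕ} → Hypergraph n → Set
Uniform r {n} H = (e : Subset n) → H e ≡ true → ∣ e ∣ ≡ r

allSubsets : (n : ℕ) → List (Subset n)
allSubsets zero = [] ∷ []
allSubsets (suc n) = map (true ∷_) (allSubsets n) ++ map (false ∷_) (allSubsets n)

numEdges : {n : ℕ} → Hypergraph n → ℕ
numEdges {n} H = sum (map (λ e → if H e then 1 else 0) (allSubsets n))

image : {k n : ℕ} → (Fin k → Fin n) → Subset k → Subset n
image {zero} φ [] = ⊥
image {suc k} φ (b ∷ e) = (if b then ⁅ φ zero ⁆ else ⊥) ∪ image (λ x → φ (suc x)) e

Contains : {n k : ℕ} → Hypergraph n → Hypergraph k → Set
Contains {n} {k} H F =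
  Σ (Fin k → Fin n) λ φ → Injective _≡_ _≡_ φ × ((e : Subset k) → F e ≡ true → H (image φ e) ≡ true)

-- M^r_{t}: t pairwise disjoint hyperedges of size r, on vertex set Fin (t * r);
-- vertex x lies in block proj₁ (remQuot r x).
block : (t r : ℕ) → Fin t → Subset (t * r)
block t r i = tabulate λ x → ⌊ proj₁ (remQuot {t} r x) FinP.≟ i ⌋

Matching : (t r : ℕ) → Hypergraph (t * r)
Matching t r e = ⌊ FinP.any? (λ i → VecP.≡-dec BoolP._≟_ e (block t r i)) ⌋

-- The link (r-1)-graph of vertex v in F (on the same vertex set; v is isolated in it).
link : {k : ℕ} → Hypergraph k → Fin k → Hypergraph k
link F v e = not (lookup e v) ∧ F (e ∪ ⁅ v ⁆)

-- m = ex_r(n, 𝓕), where Free H expresses that H contains no member of 𝓕: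
-- m is attained by some 𝓕-free n-vertex r-graph and bounds all of them.
IsEx : (r n : ℕ) → (Hypergraph n → Set) → ℕ → Set
IsEx r n Free m =
  (Σ (Hypergraph n) λ H → Uniform r H × Free H × numEdges H ≡ m)
  × ((H : Hypergraph n) → Uniform r H → Free H → numEdges H ≤ m)

FreeFM : {n k : ℕ} (r s : ℕ) → Hypergraph k → Hypergraph n → Set
FreeFM r s F H = ¬ Contains H F × ¬ Contains H (Matching (suc s) r)

FreeOf : {n k : ℕ} → Hypergraph k → Hypergraph n → Set
FreeOf F H = ¬ Contains H F

{-# OPTIONS --safe #-}
-- Two estimates drive both cases.  An r-graph H without s + 1 pairwise disjoint edges has a
-- transversal of at most (s + 1) r vertices (the union of a maximal family of disjoint edges),
-- so |H| ≤ (s + 1) r · maxₓ |link H x|.  A cone (every edge through one vertex u) has no two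
-- disjoint edges, and in a copy of F inside it the vertex mapped to u lies in every edge of F.
--
-- If no vertex of F lies in every edge, the cone over u of all (r-1)-sets avoiding u is
-- {F, M}-free with C(n-1, r-1) ≥ (n / 2(r-1))^(r-1) edges, while links have at most n^(r-1).
-- If v lies in every edge of F, with link F': a copy of F' in link H x lifts to a copy of F in H,
-- so the links of an {F, M}-free H are F'-free; a copy of F in the cone over an (r-1)-graph G
-- restricts to a copy of F' in G, so cones over F'-free G are {F, M}-free, and since every edge
-- of G misses one of any r vertices, |G| ≤ r · maxᵤ |cone G u|.

module Submission where

open import Defs
open import Data.Bool using (Bool; true; false; if_then_else_; _∧_; not)
open import Data.Nat using (ℕ; zero; suc; _+_; _*_; _∸_; _^_; _≤_; _<_; z≤n; s≤s; _≡ᵇ_; >-nonZero)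
open import Data.Nat.DivMod using (_/_; _%_; m≡m%n+[m/n]*n; m%n<n; m/n*n≤m; m≥n⇒m/n>0)
open import Data.Nat.Properties
  using (≤-refl; ≤-reflexive; ≤-trans; ≤-<-trans; +-identityʳ; +-suc; +-mono-≤; +-monoˡ-≤; +-monoʳ-≤;
         *-comm; *-distribˡ-+; *-distribʳ-+; *-monoˡ-≤; *-monoʳ-≤; ^-monoˡ-≤; m≤m+n; m≤n+m; m≤n*m;
         n≤1+n; m∸n+n≡m; suc-injective; ≡ᵇ⇒≡; ≡⇒≡ᵇ; module ≤-Reasoning;
         +-commutativeSemigroup; *-commutativeSemigroup; +-*-semiring)
open import Algebra.Properties.CommutativeSemigroup +-commutativeSemigroup using (interchange)
open import Algebra.Properties.CommutativeSemigroup *-commutativeSemigroup using ()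
  renaming (interchange to *-interchange)
open import Algebra.Properties.Semiring.Sum +-*-semiring using (sum; sum-syntax; sum-cong-≗; *-distribʳ-sum)
open import Data.Fin using (Fin; zero; suc; _≟_; remQuot; combine)
open import Data.Fin.Properties
  using (remQuot-combine; combine-remQuot) renaming (suc-injective to Fin-suc-injective)
open import Data.Fin.Subset using (Subset; inside; outside; ⊥; ⁅_⁆; _∪_; _∩_; _-_; ∣_∣; _∈_; _∉_; _⊆_)
open import Data.Fin.Subset.Properties
  using (∣p∣≤∣x∷p∣; drop-there; drop-not-there; ∉⊥; x∈⁅x⁆; x∈⁅y⁆⇒x≡y; ⊆-antisym; ∪-identityʳ;
         x∈p∪q⁻; x∈p∪q⁺; p─q⊆p; x∈p∧x≢y⇒x∈p-y; x∈p∩q⁺; x∈p∩q⁻; ∣⊥∣≡0; nonempty?; anySubset?)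
open import Data.Fin.Permutation.Components using (transpose; transpose-inverse)
open import Data.Bool.Properties using (∨-identityʳ; T-≡) renaming (_≟_ to _≟ᵇ_)
open import Function.Bundles using (Equivalence)
open import Data.Sum using (_⊎_; inj₁; inj₂)
open import Data.Empty using (⊥-elim)
open import Function.Definitions using (Injective)
open import Relation.Nullary using (¬_; yes; no)
open import Relation.Nullary.Decidable
  using (dec-true; dec-false; ⌊_⌋; toWitness; fromWitness; ¬?; _×-dec_; decidable-stable)
open import Data.Vec using ([]; _∷_; lookup; insertAt; _++_; here; there)
open import Data.Vec.Properties using (insertAt-lookup; []=⇒lookup; lookup⇒[]=; lookup∘tabulate)
open import Data.List using (map) renaming (_++_ to _++ᴸ_)
import Data.List.Properties as List
open import Data.Nat.ListAction using () renaming (sum to sumᴸ)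
open import Data.Nat.ListAction.Properties using () renaming (sum-++ to sumᴸ-++)
open import Data.Product using (Σ; ∃; ∃-syntax; _×_; _,_; proj₁; proj₂; uncurry)
open import Function using (_∘_)
import Data.Vec.Functional as Vector
open import Relation.Binary.PropositionalEquality

private
  variable
    k n : ℕ
    x y : Fin n
    p e : Subset n
    F : Hypergraph k
    G H : Hypergraph n


-- Sums over all subsets

𝟙 : Bool → ℕ
𝟙 b = if b then 1 else 0

𝟙-mono : {a b : Bool} → (a ≡ true → b ≡ true) → 𝟙 a ≤ 𝟙 b
𝟙-mono {false} _ = z≤n
𝟙-mono {true}  h rewrite h refl = ≤-refl

𝟙-mono₂ : {a b c : Bool} → (a ≡ true → b ≡ true → c ≡ true) → 𝟙 a * 𝟙 b ≤ 𝟙 c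
𝟙-mono₂ {true}  {true}  h rewrite h refl refl = ≤-refl
𝟙-mono₂ {true}  {false} h = z≤n
𝟙-mono₂ {false}         h = z≤n

∑ₛ : (Subset n → ℕ) → ℕ
∑ₛ {zero}  g = g []
∑ₛ {suc n} g = ∑ₛ (g ∘ (inside ∷_)) + ∑ₛ (g ∘ (outside ∷_))

sum-map-allSubsets : ∀ n (g : Subset n → ℕ) → sumᴸ (map g (allSubsets n)) ≡ ∑ₛ g
sum-map-allSubsets zero    g = +-identityʳ (g [])
sum-map-allSubsets (suc n) g = begin
  sumᴸ (map g (map (inside ∷_) A ++ᴸ map (outside ∷_) A))
    ≡⟨ cong sumᴸ (List.map-++ g (map (inside ∷_) A) _) ⟩
  sumᴸ (map g (map (inside ∷_) A) ++ᴸ map g (map (outside ∷_) A))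
    ≡⟨ sumᴸ-++ (map g (map (inside ∷_) A)) _ ⟩
  sumᴸ (map g (map (inside ∷_) A)) + sumᴸ (map g (map (outside ∷_) A))
    ≡⟨ cong₂ _+_ (cong sumᴸ (sym (List.map-∘ A))) (cong sumᴸ (sym (List.map-∘ A))) ⟩
  sumᴸ (map (g ∘ (inside ∷_)) A) + sumᴸ (map (g ∘ (outside ∷_)) A)
    ≡⟨ cong₂ _+_ (sum-map-allSubsets n _) (sum-map-allSubsets n _) ⟩
  ∑ₛ g ∎
  where open ≡-Reasoning
        A = allSubsets n

numEdges≡∑ₛ : (H : Hypergraph n) → numEdges H ≡ ∑ₛ (𝟙 ∘ H)
numEdges≡∑ₛ H = sum-map-allSubsets _ (𝟙 ∘ H)

∑ₛ-cong : {g h : Subset n → ℕ} → (∀ f → g f ≡ h f) → ∑ₛ g ≡ ∑ₛ h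
∑ₛ-cong {zero}  eq = eq []
∑ₛ-cong {suc n} eq = cong₂ _+_ (∑ₛ-cong (eq ∘ (inside ∷_))) (∑ₛ-cong (eq ∘ (outside ∷_)))

∑ₛ-mono-≤ : {g h : Subset n → ℕ} → (∀ f → g f ≤ h f) → ∑ₛ g ≤ ∑ₛ h
∑ₛ-mono-≤ {zero}  le = le []
∑ₛ-mono-≤ {suc n} le = +-mono-≤ (∑ₛ-mono-≤ (le ∘ (inside ∷_))) (∑ₛ-mono-≤ (le ∘ (outside ∷_)))

∑ₛ-zero : ∀ n → ∑ₛ {n} (λ _ → 0) ≡ 0
∑ₛ-zero zero    = refl
∑ₛ-zero (suc n) = cong₂ _+_ (∑ₛ-zero n) (∑ₛ-zero n)

∑ₛ-distrib-+ : (g h : Subset n → ℕ) → ∑ₛ (λ f → g f + h f) ≡ ∑ₛ g + ∑ₛ h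
∑ₛ-distrib-+ {zero}  g h = refl
∑ₛ-distrib-+ {suc n} g h = begin
  ∑ₛ (λ f → g (inside ∷ f) + h (inside ∷ f)) + ∑ₛ (λ f → g (outside ∷ f) + h (outside ∷ f))
    ≡⟨ cong₂ _+_ (∑ₛ-distrib-+ (g ∘ (inside ∷_)) (h ∘ (inside ∷_)))
                 (∑ₛ-distrib-+ (g ∘ (outside ∷_)) (h ∘ (outside ∷_))) ⟩
  (∑ₛ (g ∘ (inside ∷_)) + ∑ₛ (h ∘ (inside ∷_))) + (∑ₛ (g ∘ (outside ∷_)) + ∑ₛ (h ∘ (outside ∷_)))
    ≡⟨ interchange (∑ₛ (g ∘ (inside ∷_))) (∑ₛ (h ∘ (inside ∷_))) _ _ ⟩
  ∑ₛ g + ∑ₛ h ∎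
  where open ≡-Reasoning

*-distribˡ-∑ₛ : ∀ c (g : Subset n → ℕ) → c * ∑ₛ g ≡ ∑ₛ (λ f → c * g f)
*-distribˡ-∑ₛ {zero}  c g = refl
*-distribˡ-∑ₛ {suc n} c g =
  trans (*-distribˡ-+ c _ _)
        (cong₂ _+_ (*-distribˡ-∑ₛ c (g ∘ (inside ∷_))) (*-distribˡ-∑ₛ c (g ∘ (outside ∷_))))

*-distribʳ-∑ₛ : ∀ c (g : Subset n → ℕ) → ∑ₛ g * c ≡ ∑ₛ (λ f → g f * c)
*-distribʳ-∑ₛ {zero}  c g = refl
*-distribʳ-∑ₛ {suc n} c g =
  trans (*-distribʳ-+ c (∑ₛ (g ∘ (inside ∷_))) _)
        (cong₂ _+_ (*-distribʳ-∑ₛ c (g ∘ (inside ∷_))) (*-distribʳ-∑ₛ c (g ∘ (outside ∷_))))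

∑ₛ-++ : ∀ m {n} (g : Subset (m + n) → ℕ) → ∑ₛ g ≡ ∑ₛ {m} (λ a → ∑ₛ {n} (λ b → g (a ++ b)))
∑ₛ-++ zero    g = refl
∑ₛ-++ (suc m) g = cong₂ _+_ (∑ₛ-++ m _) (∑ₛ-++ m _)

∑ₛ-insertAt : (u : Fin (suc n)) (g : Subset (suc n) → ℕ) →
  ∑ₛ g ≡ ∑ₛ (λ f → g (insertAt f u inside)) + ∑ₛ (λ f → g (insertAt f u outside))
∑ₛ-insertAt         zero    g = refl
∑ₛ-insertAt {suc n} (suc u) g =
  trans (cong₂ _+_ (∑ₛ-insertAt u (g ∘ (inside ∷_))) (∑ₛ-insertAt u (g ∘ (outside ∷_))))
        (interchange (∑ₛ (λ f → g (inside ∷ insertAt f u inside)))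
                     (∑ₛ (λ f → g (inside ∷ insertAt f u outside))) _ _)

sum-mono-≤ : ∀ {m} {g h : Fin m → ℕ} → (∀ i → g i ≤ h i) → sum g ≤ sum h
sum-mono-≤ {zero}  le = z≤n
sum-mono-≤ {suc m} le = +-mono-≤ (le zero) (sum-mono-≤ (le ∘ suc))

term≤sum : ∀ {m} (g : Fin m → ℕ) i → g i ≤ sum g
term≤sum {suc m} g zero    = m≤m+n _ _
term≤sum {suc m} g (suc i) = ≤-trans (term≤sum (g ∘ suc) i) (m≤n+m _ _)

∑ₛ-sum-comm : ∀ {m} (g : Fin m → Subset n → ℕ) → ∑ₛ (λ f → ∑[ i < m ] g i f) ≡ ∑[ i < m ] ∑ₛ (g i)
∑ₛ-sum-comm {n} {zero}  g = ∑ₛ-zero n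
∑ₛ-sum-comm     {m = suc m} g =
  trans (∑ₛ-distrib-+ (g zero) _) (cong (∑ₛ (g zero) +_) (∑ₛ-sum-comm (g ∘ suc)))

sum-𝟙-lookup : (T : Subset n) → ∑[ i < n ] 𝟙 (lookup T i) ≡ ∣ T ∣
sum-𝟙-lookup []            = refl
sum-𝟙-lookup (inside ∷ T)  = cong suc (sum-𝟙-lookup T)
sum-𝟙-lookup (outside ∷ T) = sum-𝟙-lookup T

lookup≡false⇒∉ : lookup p x ≡ false → x ∉ p
lookup≡false⇒∉ eq x∈p with trans (sym ([]=⇒lookup x∈p)) eq
... | ()

∉⇒lookup≡false : x ∉ p → lookup p x ≡ false
∉⇒lookup≡false {x = x} {p} x∉p with lookup p x in eq
... | true  = ⊥-elim (x∉p (lookup⇒[]= x p eq))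
... | false = refl

∣p∪q∣≤∣p∣+∣q∣ : (p q : Subset n) → ∣ p ∪ q ∣ ≤ ∣ p ∣ + ∣ q ∣
∣p∪q∣≤∣p∣+∣q∣ []            []            = z≤n
∣p∪q∣≤∣p∣+∣q∣ (inside ∷ p)  (b ∷ q)       =
  s≤s (≤-trans (∣p∪q∣≤∣p∣+∣q∣ p q) (+-monoʳ-≤ ∣ p ∣ (∣p∣≤∣x∷p∣ b q)))
∣p∪q∣≤∣p∣+∣q∣ (outside ∷ p) (inside ∷ q)  =
  ≤-trans (s≤s (∣p∪q∣≤∣p∣+∣q∣ p q)) (≤-reflexive (sym (+-suc ∣ p ∣ ∣ q ∣)))
∣p∪q∣≤∣p∣+∣q∣ (outside ∷ p) (outside ∷ q) = ∣p∪q∣≤∣p∣+∣q∣ p q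

∣p∪⁅x⁆∣≡1+∣p∣ : (p : Subset n) (x : Fin n) → x ∉ p → ∣ p ∪ ⁅ x ⁆ ∣ ≡ suc ∣ p ∣
∣p∪⁅x⁆∣≡1+∣p∣ (inside ∷ p)  zero    x∉p = ⊥-elim (x∉p here)
∣p∪⁅x⁆∣≡1+∣p∣ (outside ∷ p) zero    x∉p = cong (suc ∘ ∣_∣) (∪-identityʳ p)
∣p∪⁅x⁆∣≡1+∣p∣ (inside ∷ p)  (suc x) x∉p = cong suc (∣p∪⁅x⁆∣≡1+∣p∣ p x (drop-not-there x∉p))
∣p∪⁅x⁆∣≡1+∣p∣ (outside ∷ p) (suc x) x∉p = ∣p∪⁅x⁆∣≡1+∣p∣ p x (drop-not-there x∉p)

∣p++q∣≡∣p∣+∣q∣ : ∀ {m} (p : Subset m) (q : Subset n) → ∣ p ++ q ∣ ≡ ∣ p ∣ + ∣ q ∣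
∣p++q∣≡∣p∣+∣q∣ []            q = refl
∣p++q∣≡∣p∣+∣q∣ (inside ∷ p)  q = cong suc (∣p++q∣≡∣p∣+∣q∣ p q)
∣p++q∣≡∣p∣+∣q∣ (outside ∷ p) q = ∣p++q∣≡∣p∣+∣q∣ p q

x∉p-x : (p : Subset n) (x : Fin n) → x ∉ p - x
x∉p-x (b ∷ p) (suc x) (there x∈p-x) = x∉p-x p x x∈p-x

∈p-x⇒≢ : y ∈ p - x → y ≢ x
∈p-x⇒≢ {p = p} {x = x} y∈p-x refl = x∉p-x p x y∈p-x

[p-x]∪⁅x⁆≡p : x ∈ p → (p - x) ∪ ⁅ x ⁆ ≡ p
[p-x]∪⁅x⁆≡p {x = x} {p = p} x∈p = ⊆-antisym ⊆p ⊇p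
  where
  ⊆p : (p - x) ∪ ⁅ x ⁆ ⊆ p
  ⊆p {y} y∈ with x∈p∪q⁻ (p - x) ⁅ x ⁆ y∈
  ... | inj₁ y∈p-x = p─q⊆p p ⁅ x ⁆ y∈p-x
  ... | inj₂ y∈⁅x⁆ = subst (_∈ p) (sym (x∈⁅y⁆⇒x≡y x y∈⁅x⁆)) x∈p
  ⊇p : p ⊆ (p - x) ∪ ⁅ x ⁆
  ⊇p {y} y∈p with y ≟ x
  ... | yes refl = x∈p∪q⁺ (inj₂ (x∈⁅x⁆ x))
  ... | no y≢x   = x∈p∪q⁺ (inj₁ (x∈p∧x≢y⇒x∈p-y y∈p y≢x))

p∪⁅x⁆-x≡p : x ∉ p → p ∪ ⁅ x ⁆ - x ≡ p
p∪⁅x⁆-x≡p {x = x} {p = p} x∉p = ⊆-antisym ⊆p ⊇p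
  where
  ⊆p : p ∪ ⁅ x ⁆ - x ⊆ p
  ⊆p {y} y∈ with x∈p∪q⁻ p ⁅ x ⁆ (p─q⊆p (p ∪ ⁅ x ⁆) ⁅ x ⁆ y∈)
  ... | inj₁ y∈p   = y∈p
  ... | inj₂ y∈⁅x⁆ = ⊥-elim (∈p-x⇒≢ y∈ (x∈⁅y⁆⇒x≡y x y∈⁅x⁆))
  ⊇p : p ⊆ p ∪ ⁅ x ⁆ - x
  ⊇p {y} y∈p = x∈p∧x≢y⇒x∈p-y (x∈p∪q⁺ (inj₁ y∈p)) λ { refl → x∉p y∈p }

insertAt-outside∪⁅⁆ : (f : Subset n) (u : Fin (suc n)) →
  insertAt f u outside ∪ ⁅ u ⁆ ≡ insertAt f u inside
insertAt-outside∪⁅⁆ f       zero    = cong (inside ∷_) (∪-identityʳ f)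
insertAt-outside∪⁅⁆ (b ∷ f) (suc u) = cong₂ _∷_ (∨-identityʳ b) (insertAt-outside∪⁅⁆ f u)

subset-of-size : ∀ {r} → r ≤ n → Σ (Subset n) λ S → ∣ S ∣ ≡ r
subset-of-size {n}     z≤n       = ⊥ , ∣⊥∣≡0 n
subset-of-size (s≤s r≤n) with S , ∣S∣≡r ← subset-of-size r≤n = inside ∷ S , cong suc ∣S∣≡r

pigeonhole : (S f : Subset n) → ∣ f ∣ < ∣ S ∣ → ∃[ x ] x ∈ S × x ∉ f
pigeonhole (inside ∷ S)  (outside ∷ f) _ = zero , here , λ ()
pigeonhole (inside ∷ S)  (inside ∷ f)  (s≤s ∣f∣<∣S∣)
  with x , x∈S , x∉f ← pigeonhole S f ∣f∣<∣S∣ = suc x , there x∈S , x∉f ∘ drop-there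
pigeonhole (outside ∷ S) (b ∷ f)       ∣f∣<∣S∣
  with x , x∈S , x∉f ← pigeonhole S f (≤-<-trans (∣p∣≤∣x∷p∣ b f) ∣f∣<∣S∣) =
  suc x , there x∈S , x∉f ∘ drop-there

⋃ᶠ : ∀ {t} → (Fin t → Subset n) → Subset n
⋃ᶠ {t = zero}  E = ⊥
⋃ᶠ {t = suc t} E = E zero ∪ ⋃ᶠ (E ∘ suc)

∈-⋃ᶠ⁺ : ∀ {t} (E : Fin t → Subset n) i → x ∈ E i → x ∈ ⋃ᶠ E
∈-⋃ᶠ⁺ E zero    x∈ = x∈p∪q⁺ (inj₁ x∈)
∈-⋃ᶠ⁺ E (suc i) x∈ = x∈p∪q⁺ (inj₂ (∈-⋃ᶠ⁺ (E ∘ suc) i x∈))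

∣⋃ᶠ∣≤ : ∀ {t r} (E : Fin t → Subset n) → (∀ i → ∣ E i ∣ ≡ r) → ∣ ⋃ᶠ E ∣ ≤ t * r
∣⋃ᶠ∣≤ {n} {zero}  E _     = ≤-reflexive (∣⊥∣≡0 n)
∣⋃ᶠ∣≤ {t = suc t} E ∣E∣≡r = begin
  ∣ E zero ∪ ⋃ᶠ (E ∘ suc) ∣       ≤⟨ ∣p∪q∣≤∣p∣+∣q∣ (E zero) _ ⟩
  ∣ E zero ∣ + ∣ ⋃ᶠ (E ∘ suc) ∣
    ≤⟨ +-mono-≤ (≤-reflexive (∣E∣≡r zero)) (∣⋃ᶠ∣≤ (E ∘ suc) (∣E∣≡r ∘ suc)) ⟩
  _ + t * _                        ∎
  where open ≤-Reasoning

transpose-matchˡ : (i j : Fin n) → transpose i j i ≡ j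
transpose-matchˡ i j rewrite dec-true (i ≟ i) refl = refl

transpose-other : {i j k : Fin n} → k ≢ i → k ≢ j → transpose i j k ≡ k
transpose-other {i = i} {j} {k} k≢i k≢j rewrite dec-false (k ≟ i) k≢i | dec-false (k ≟ j) k≢j = refl

transpose-injective : (i j : Fin n) → Injective _≡_ _≡_ (transpose i j)
transpose-injective i j {a} {b} eq = begin
  a                                 ≡⟨ sym (transpose-inverse j i) ⟩
  transpose j i (transpose i j a)   ≡⟨ cong (transpose j i) eq ⟩
  transpose j i (transpose i j b)   ≡⟨ transpose-inverse j i ⟩
  b                                 ∎
  where open ≡-Reasoning

transpose-∈ : {i j z : Fin n} → i ∈ p → j ∈ p → z ∈ p → transpose i j z ∈ p
transpose-∈ {i = i} {j} {z} i∈p j∈p z∈p with z ≟ i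
... | yes _ = j∈p
... | no _ with z ≟ j
...   | yes _ = i∈p
...   | no _  = z∈p

∈-image⁺ : (φ : Fin k → Fin n) {e : Subset k} {x : Fin k} → x ∈ e → φ x ∈ image φ e
∈-image⁺ φ {x = zero}  here         = x∈p∪q⁺ (inj₁ (x∈⁅x⁆ (φ zero)))
∈-image⁺ φ {x = suc x} (there x∈e) = x∈p∪q⁺ (inj₂ (∈-image⁺ (φ ∘ suc) x∈e))

∈-image⁻ : (φ : Fin k → Fin n) (e : Subset k) → y ∈ image φ e → ∃[ x ] x ∈ e × φ x ≡ y
∈-image⁻ φ []      y∈ = ⊥-elim (∉⊥ y∈)
∈-image⁻ φ (b ∷ e) y∈ with b | x∈p∪q⁻ (if b then ⁅ φ zero ⁆ else ⊥) (image (φ ∘ suc) e) y∈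
... | inside  | inj₁ y∈⁅φ0⁆ = zero , here , sym (x∈⁅y⁆⇒x≡y (φ zero) y∈⁅φ0⁆)
... | outside | inj₁ y∈⊥    = ⊥-elim (∉⊥ y∈⊥)
... | _       | inj₂ y∈rest with ∈-image⁻ (φ ∘ suc) e y∈rest
...   | x , x∈e , φx≡y = suc x , there x∈e , φx≡y

image-cong : {φ ψ : Fin k → Fin n} (e : Subset k) → (∀ {x} → x ∈ e → φ x ≡ ψ x) →
  image φ e ≡ image ψ e
image-cong []            eq = refl
image-cong (inside ∷ e)  eq = cong₂ _∪_ (cong ⁅_⁆ (eq here)) (image-cong e (eq ∘ there))
image-cong (outside ∷ e) eq = cong (⊥ ∪_) (image-cong e (eq ∘ there))

image-∘ : ∀ {m} (ψ : Fin n → Fin m) (φ : Fin k → Fin n) (e : Subset k) →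
  image (ψ ∘ φ) e ≡ image ψ (image φ e)
image-∘ ψ φ e = ⊆-antisym ⊆ψφ ⊇ψφ
  where
  ⊆ψφ : image (ψ ∘ φ) e ⊆ image ψ (image φ e)
  ⊆ψφ y∈ with ∈-image⁻ (ψ ∘ φ) e y∈
  ... | x , x∈e , refl = ∈-image⁺ ψ (∈-image⁺ φ x∈e)
  ⊇ψφ : image ψ (image φ e) ⊆ image (ψ ∘ φ) e
  ⊇ψφ y∈ with ∈-image⁻ ψ (image φ e) y∈
  ... | z , z∈ , refl with ∈-image⁻ φ e z∈
  ...   | x , x∈e , refl = ∈-image⁺ (ψ ∘ φ) x∈e

image-∪⁅⁆ : (φ : Fin k → Fin n) (e : Subset k) (x : Fin k) →
  image φ (e ∪ ⁅ x ⁆) ≡ image φ e ∪ ⁅ φ x ⁆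
image-∪⁅⁆ φ e x = ⊆-antisym ⊆∪ ⊇∪
  where
  ⊆∪ : image φ (e ∪ ⁅ x ⁆) ⊆ image φ e ∪ ⁅ φ x ⁆
  ⊆∪ y∈ with ∈-image⁻ φ (e ∪ ⁅ x ⁆) y∈
  ... | z , z∈ , refl with x∈p∪q⁻ e ⁅ x ⁆ z∈
  ...   | inj₁ z∈e   = x∈p∪q⁺ (inj₁ (∈-image⁺ φ z∈e))
  ...   | inj₂ z∈⁅x⁆ rewrite x∈⁅y⁆⇒x≡y x z∈⁅x⁆ = x∈p∪q⁺ (inj₂ (x∈⁅x⁆ (φ x)))
  ⊇∪ : image φ e ∪ ⁅ φ x ⁆ ⊆ image φ (e ∪ ⁅ x ⁆)
  ⊇∪ {y} y∈ with x∈p∪q⁻ (image φ e) ⁅ φ x ⁆ y∈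
  ... | inj₁ y∈φe with ∈-image⁻ φ e y∈φe
  ...   | z , z∈e , refl = ∈-image⁺ φ (x∈p∪q⁺ (inj₁ z∈e))
  ⊇∪ {y} y∈ | inj₂ y∈⁅φx⁆ rewrite x∈⁅y⁆⇒x≡y (φ x) y∈⁅φx⁆ =
    ∈-image⁺ φ (x∈p∪q⁺ (inj₂ (x∈⁅x⁆ x)))

∉-image : {φ : Fin k → Fin n} → Injective _≡_ _≡_ φ → (e : Subset k) → x ∉ e → φ x ∉ image φ e
∉-image {φ = φ} inj e x∉e φx∈ with ∈-image⁻ φ e φx∈
... | z , z∈e , φz≡φx = x∉e (subst (_∈ e) (inj φz≡φx) z∈e)

image-transpose : {i j : Fin n} → i ∈ p → j ∈ p → image (transpose i j) p ≡ p
image-transpose {p = p} {i} {j} i∈p j∈p = ⊆-antisym ⊆p ⊇p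
  where
  ⊆p : image (transpose i j) p ⊆ p
  ⊆p y∈ with ∈-image⁻ (transpose i j) p y∈
  ... | z , z∈p , refl = transpose-∈ i∈p j∈p z∈p
  ⊇p : p ⊆ image (transpose i j) p
  ⊇p {y} y∈p = subst (_∈ image (transpose i j) p) (transpose-inverse i j)
                     (∈-image⁺ (transpose i j) (transpose-∈ j∈p i∈p y∈p))

-- Embeddings, centres, links and cones

Embedding : Hypergraph k → Hypergraph n → (Fin k → Fin n) → Set
Embedding {k} F H φ = Injective _≡_ _≡_ φ × ((e : Subset k) → F e ≡ true → H (image φ e) ≡ true)

Centre : Hypergraph k → Fin k → Set
Centre {k} F v = (e : Subset k) → F e ≡ true → lookup e v ≡ true

centre-∈ : {v : Fin k} → Centre F v → F e ≡ true → v ∈ e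
centre-∈ {e = e} {v} cF Fe = lookup⇒[]= v e (cF e Fe)

Contains-⊆ : {F : Hypergraph k} → (∀ e → G e ≡ true → H e ≡ true) → Contains G F → Contains H F
Contains-⊆ G⊆H (φ , φ-inj , φ-hom) = φ , φ-inj , λ e Fe → G⊆H _ (φ-hom e Fe)

embedding-centre : {φ : Fin k → Fin n} {u : Fin n} → Centre H u → (∃[ e ] F e ≡ true) →
  Embedding F H φ → ∃[ w ] φ w ≡ u × Centre F w
embedding-centre {φ = φ} cH (e₀ , Fe₀) (φ-inj , φ-hom)
  with w , _ , φw≡u ← ∈-image⁻ φ e₀ (centre-∈ cH (φ-hom e₀ Fe₀)) = w , φw≡u , cF
  where
  cF : Centre _ w
  cF e Fe with z , z∈e , φz≡u ← ∈-image⁻ φ e (centre-∈ cH (φ-hom e Fe)) =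
    []=⇒lookup (subst (_∈ e) (φ-inj (trans φz≡u (sym φw≡u))) z∈e)

Contains-centred : {u : Fin n} → Centre H u → (∃[ e ] F e ≡ true) → Contains H F → ∃ (Centre F)
Contains-centred cH edge (φ , emb) with w , _ , cw ← embedding-centre cH edge emb = w , cw

-- Two centres of F are interchangeable: swapping them fixes every edge.
embedding-∘-transpose : {φ : Fin k → Fin n} {v w : Fin k} → Centre F v → Centre F w →
  Embedding F H φ → Embedding F H (φ ∘ transpose v w)
embedding-∘-transpose {H = H} {φ} {v} {w} cv cw (φ-inj , φ-hom) =
  transpose-injective v w ∘ φ-inj , hom
  where
  hom : ∀ e → _ ≡ true → H (image (φ ∘ transpose v w) e) ≡ true
  hom e Fe = subst (λ S → H S ≡ true) (sym image-eq) (φ-hom e Fe)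
    where
    image-eq : image (φ ∘ transpose v w) e ≡ image φ e
    image-eq = trans (image-∘ φ (transpose v w) e)
                     (cong (image φ) (image-transpose (centre-∈ cv Fe) (centre-∈ cw Fe)))

link⁻ : link H x e ≡ true → x ∉ e × H (e ∪ ⁅ x ⁆) ≡ true
link⁻ {x = x} {e} l with lookup e x in eq
... | false = lookup≡false⇒∉ eq , l

link⁺ : x ∉ e → H (e ∪ ⁅ x ⁆) ≡ true → link H x e ≡ true
link⁺ x∉e h rewrite ∉⇒lookup≡false x∉e = h

link-uniform : ∀ j → Uniform (suc j) H → Uniform j (link H x)
link-uniform {H = H} {x = x} j UH e l with x∉e , H[e∪x] ← link⁻ {H = H} l =
  suc-injective (trans (sym (∣p∪⁅x⁆∣≡1+∣p∣ e x x∉e)) (UH (e ∪ ⁅ x ⁆) H[e∪x]))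

link-embedding : {φ : Fin k → Fin n} {v : Fin k} {x : Fin n} →
  Embedding F H φ → φ v ≡ x → Embedding (link F v) (link H x) φ
link-embedding {F = F} {H} {φ} {v} (φ-inj , φ-hom) refl = φ-inj , hom
  where
  hom : ∀ e → link F v e ≡ true → link H (φ v) (image φ e) ≡ true
  hom e l with link⁻ {H = F} l
  ... | v∉e , F[e∪v] = link⁺ {H = H} (∉-image φ-inj e v∉e)
    (subst (λ S → H S ≡ true) (image-∪⁅⁆ φ e v) (φ-hom (e ∪ ⁅ v ⁆) F[e∪v]))

-- Composing ψ with the transposition of ψ v and x sends v to x and moves no vertex of a link edge.
link-lift : {v : Fin k} {x : Fin n} → Centre F v → Contains (link H x) (link F v) → Contains H F
link-lift {k = k} {F = F} {H = H} {v} {x} cF (ψ , ψ-inj , ψ-hom) =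
  φ , ψ-inj ∘ transpose-injective (ψ v) x , φ-hom
  where
  φ : Fin k → Fin _
  φ = transpose (ψ v) x ∘ ψ
  φ-hom : (e : Subset k) → F e ≡ true → H (image φ e) ≡ true
  φ-hom e Fe = subst (λ S → H S ≡ true) (sym image-φ-e) (proj₂ link-edge)
    where
    v∈e : v ∈ e
    v∈e = centre-∈ cF Fe
    link-edge : x ∉ image ψ (e - v) × H (image ψ (e - v) ∪ ⁅ x ⁆) ≡ true
    link-edge = link⁻ {H = H} (ψ-hom (e - v)
      (link⁺ {H = F} (x∉p-x e v) (subst (λ S → F S ≡ true) (sym ([p-x]∪⁅x⁆≡p v∈e)) Fe)))
    φ≗ψ : ∀ {z} → z ∈ e - v → φ z ≡ ψ z
    φ≗ψ z∈e-v = transpose-other (∈p-x⇒≢ z∈e-v ∘ ψ-inj)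
      λ ψz≡x → proj₁ link-edge (subst (_∈ _) ψz≡x (∈-image⁺ ψ z∈e-v))
    image-φ-e : image φ e ≡ image ψ (e - v) ∪ ⁅ x ⁆
    image-φ-e = begin
      image φ e                   ≡⟨ cong (image φ) (sym ([p-x]∪⁅x⁆≡p v∈e)) ⟩
      image φ ((e - v) ∪ ⁅ v ⁆)   ≡⟨ image-∪⁅⁆ φ (e - v) v ⟩
      image φ (e - v) ∪ ⁅ φ v ⁆   ≡⟨ cong₂ _∪_ (image-cong (e - v) φ≗ψ)
                                               (cong ⁅_⁆ (transpose-matchˡ (ψ v) x)) ⟩
      image ψ (e - v) ∪ ⁅ x ⁆     ∎
      where open ≡-Reasoning

cone : Hypergraph n → Fin n → Hypergraph n
cone G u f = lookup f u ∧ G (f - u)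

cone⁻ : (G : Hypergraph n) (u : Fin n) (f : Subset n) →
  cone G u f ≡ true → u ∈ f × G (f - u) ≡ true
cone⁻ G u f c with lookup f u in eq
... | true = lookup⇒[]= u f eq , c

cone-centre : (G : Hypergraph n) (u : Fin n) → Centre (cone G u) u
cone-centre G u f c = []=⇒lookup (proj₁ (cone⁻ G u f c))

cone-uniform : {u : Fin n} → ∀ j → Uniform j G → Uniform (suc j) (cone G u)
cone-uniform {G = G} {u = u} j UG f c with cone⁻ G u f c
... | u∈f , G[f-u] = begin
  ∣ f ∣                 ≡⟨ cong ∣_∣ (sym ([p-x]∪⁅x⁆≡p u∈f)) ⟩
  ∣ (f - u) ∪ ⁅ u ⁆ ∣   ≡⟨ ∣p∪⁅x⁆∣≡1+∣p∣ (f - u) u (x∉p-x f u) ⟩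
  suc ∣ f - u ∣         ≡⟨ cong suc (UG _ G[f-u]) ⟩
  suc j                 ∎
  where open ≡-Reasoning

link-cone⊆ : (G : Hypergraph n) (u : Fin n) (e : Subset n) → link (cone G u) u e ≡ true → G e ≡ true
link-cone⊆ G u e l with u∉e , c ← link⁻ {H = cone G u} l =
  subst (λ S → G S ≡ true) (p∪⁅x⁆-x≡p u∉e) (proj₂ (cone⁻ G u (e ∪ ⁅ u ⁆) c))

-- The vertex w sent to u is a centre of F; swapping it with v makes the embedding send v to u.
cone-Contains⇒Contains-link : {u : Fin n} {v : Fin k} → Centre F v → (∃[ e ] F e ≡ true) →
  Contains (cone G u) F → Contains G (link F v)
cone-Contains⇒Contains-link {F = F} {G = G} {u = u} {v} cF edge (φ , emb)
  with w , φw≡u , cFw ← embedding-centre (cone-centre G u) edge emb =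
  Contains-⊆ (link-cone⊆ G u) (φ ∘ transpose v w , link-embedding {H = cone G u} emb′ φ′v≡u)
  where
  emb′ : Embedding F (cone G u) (φ ∘ transpose v w)
  emb′ = embedding-∘-transpose {H = cone G u} cF cFw emb
  φ′v≡u : φ (transpose v w v) ≡ u
  φ′v≡u = trans (cong φ (transpose-matchˡ v w)) φw≡u

-- Matchings and transversals

∈-block⁻ : ∀ t r {i : Fin t} {x : Fin (t * r)} → x ∈ block t r i → proj₁ (remQuot {t} r x) ≡ i
∈-block⁻ t r {i} {x} x∈ = toWitness (Equivalence.from T-≡
  (trans (sym (lookup∘tabulate (λ y → ⌊ proj₁ (remQuot {t} r y) ≟ i ⌋) x)) ([]=⇒lookup x∈)))

∈-block⁺ : ∀ t r {i : Fin t} {x : Fin (t * r)} → proj₁ (remQuot {t} r x) ≡ i → x ∈ block t r i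
∈-block⁺ t r {i} {x} eq = lookup⇒[]= x (block t r i)
  (trans (lookup∘tabulate (λ y → ⌊ proj₁ (remQuot {t} r y) ≟ i ⌋) x)
         (Equivalence.to T-≡ (fromWitness eq)))

Matching-block : ∀ t r (i : Fin t) → Matching t r (block t r i) ≡ true
Matching-block t r i = Equivalence.to T-≡ (fromWitness (i , refl))

Matching-edge : ∀ t r {e} → Matching t r e ≡ true → ∃[ i ] e ≡ block t r i
Matching-edge t r eq = toWitness (Equivalence.from T-≡ eq)

Matching-no-centre : ∀ s r (w : Fin (suc (suc s) * r)) → ¬ Centre (Matching (suc (suc s)) r) w
Matching-no-centre s r w c
  with () ← trans (sym (∈-block⁻ _ r (centre-∈ c (Matching-block _ r zero))))
                  (∈-block⁻ _ r (centre-∈ c (Matching-block _ r (suc zero))))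

centre⇒Matching-free : ∀ s r {u : Fin n} → Centre H u → ¬ Contains H (Matching (suc (suc s)) r)
centre⇒Matching-free s r cH M⊆H
  with w , cw ← Contains-centred cH (block _ r zero , Matching-block _ r zero) M⊆H =
  Matching-no-centre s r w cw

record Enumeration (e : Subset n) (m : ℕ) : Set where
  field
    at        : Fin m → Fin n
    injective : Injective _≡_ _≡_ at
    at-∈      : ∀ a → at a ∈ e
    onto      : ∀ {y} → y ∈ e → ∃[ a ] at a ≡ y

enumerate : (e : Subset n) → Enumeration e ∣ e ∣
enumerate [] = record { at = λ () ; injective = λ { {()} } ; at-∈ = λ () ; onto = λ () }
enumerate (inside ∷ e) = record { at = at′ ; injective = injective′ ; at-∈ = at′-∈ ; onto = onto′ }
  where
  open Enumeration (enumerate e)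
  at′ : Fin (suc ∣ e ∣) → Fin (suc _)
  at′ = zero Vector.∷ (suc ∘ at)
  injective′ : Injective _≡_ _≡_ at′
  injective′ {zero}  {zero}  _  = refl
  injective′ {suc a} {suc b} eq = cong suc (injective (Fin-suc-injective eq))
  at′-∈ : ∀ a → at′ a ∈ inside ∷ e
  at′-∈ zero    = here
  at′-∈ (suc a) = there (at-∈ a)
  onto′ : ∀ {y} → y ∈ inside ∷ e → ∃[ a ] at′ a ≡ y
  onto′ here          = zero , refl
  onto′ (there y∈e) with a , refl ← onto y∈e = suc a , refl
enumerate (outside ∷ e) = record
  { at = suc ∘ at ; injective = injective ∘ Fin-suc-injective ; at-∈ = there ∘ at-∈ ; onto = onto′ }
  where
  open Enumeration (enumerate e)
  onto′ : ∀ {y} → y ∈ outside ∷ e → ∃[ a ] suc (at a) ≡ y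
  onto′ (there y∈e) with a , refl ← onto y∈e = a , refl

PairwiseDisjoint : ∀ {t} → (Fin t → Subset n) → Set
PairwiseDisjoint E = ∀ i j {x} → x ∈ E i → x ∈ E j → i ≡ j

DisjointEdges : Hypergraph n → ℕ → Set
DisjointEdges {n} H t = Σ (Fin t → Subset n) λ E → (∀ i → H (E i) ≡ true) × PairwiseDisjoint E

DisjointEdges⇒Contains-Matching : ∀ {t} r → Uniform r H → DisjointEdges H t →
  Contains H (Matching t r)
DisjointEdges⇒Contains-Matching {n} {H} {t} r UH (E , E-edge , E-disjoint) = φ , φ-inj , φ-hom
  where
  enum : (i : Fin t) → Enumeration (E i) r
  enum i = subst (Enumeration (E i)) (UH (E i) (E-edge i)) (enumerate (E i))
  open Enumeration
  g : Fin t → Fin r → Fin n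
  g i = at (enum i)
  g∈E : ∀ i a → g i a ∈ E i
  g∈E i = at-∈ (enum i)
  φ : Fin (t * r) → Fin n
  φ x = uncurry g (remQuot {t} r x)
  g-inj : ∀ {i a j b} → g i a ≡ g j b → (i , a) ≡ (j , b)
  g-inj {i} {a} {j} {b} eq with refl ← E-disjoint i j (g∈E i a) (subst (_∈ E j) (sym eq) (g∈E j b)) =
    cong (i ,_) (injective (enum i) eq)
  φ-inj : Injective _≡_ _≡_ φ
  φ-inj {x} {y} eq = begin
    x                              ≡⟨ combine-remQuot {t} r x ⟨
    uncurry combine (remQuot {t} r x)  ≡⟨ cong (uncurry combine) (g-inj eq) ⟩
    uncurry combine (remQuot {t} r y)  ≡⟨ combine-remQuot {t} r y ⟩
    y                              ∎
    where open ≡-Reasoning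
  image-block : ∀ i → image φ (block t r i) ≡ E i
  image-block i = ⊆-antisym ⊆E ⊇E
    where
    ⊆E : image φ (block t r i) ⊆ E i
    ⊆E y∈ with x , x∈ , refl ← ∈-image⁻ φ (block t r i) y∈
      rewrite sym (∈-block⁻ t r x∈) = g∈E _ _
    ⊇E : E i ⊆ image φ (block t r i)
    ⊇E y∈ with a , refl ← onto (enum i) y∈ =
      subst (_∈ image φ (block t r i)) (cong (uncurry g) (remQuot-combine i a))
        (∈-image⁺ φ (∈-block⁺ t r (cong proj₁ (remQuot-combine i a))))
  φ-hom : ∀ e → Matching t r e ≡ true → H (image φ e) ≡ true
  φ-hom e M-e with i , refl ← Matching-edge t r M-e =
    subst (λ S → H S ≡ true) (sym (image-block i)) (E-edge i)

Transversal : Hypergraph n → Subset n → Set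
Transversal {n} H T = (f : Subset n) → H f ≡ true → ∃[ x ] x ∈ T × x ∈ f

extend⊎transversal : ∀ {t} → ((E , _) : DisjointEdges H t) →
  DisjointEdges H (suc t) ⊎ Transversal H (⋃ᶠ E)
extend⊎transversal {H = H} (E , E-edge , E-disjoint)
  with anySubset? (λ f → (H f ≟ᵇ true) ×-dec ¬? (nonempty? (f ∩ ⋃ᶠ E)))
... | yes (f , Hf , f∩⋃E=∅) = inj₁ (f Vector.∷ E , edge , disjoint)
  where
  edge : ∀ i → H ((f Vector.∷ E) i) ≡ true
  edge zero    = Hf
  edge (suc i) = E-edge i
  disjoint : PairwiseDisjoint (f Vector.∷ E)
  disjoint zero    zero    _   _   = refl
  disjoint (suc i) (suc j) x∈i x∈j = cong suc (E-disjoint i j x∈i x∈j)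
  disjoint zero    (suc j) x∈f x∈j = ⊥-elim (f∩⋃E=∅ (_ , x∈p∩q⁺ (x∈f , ∈-⋃ᶠ⁺ E j x∈j)))
  disjoint (suc i) zero    x∈i x∈f = ⊥-elim (f∩⋃E=∅ (_ , x∈p∩q⁺ (x∈f , ∈-⋃ᶠ⁺ E i x∈i)))
... | no ∄f = inj₂ λ f Hf →
  let x , x∈f∩⋃E = decidable-stable (nonempty? (f ∩ ⋃ᶠ E)) (λ f∩⋃E=∅ → ∄f (f , Hf , f∩⋃E=∅))
      x∈f , x∈⋃E = x∈p∩q⁻ f (⋃ᶠ E) x∈f∩⋃E
  in x , x∈⋃E , x∈f

DisjointEdges⊎transversal : ∀ {r} → Uniform r H → ∀ t →
  DisjointEdges H t ⊎ ∃[ T ] Transversal H T × ∣ T ∣ ≤ t * r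
DisjointEdges⊎transversal UH zero = inj₁ ((λ ()) , (λ ()) , λ ())
DisjointEdges⊎transversal {r = r} UH (suc t) with DisjointEdges⊎transversal UH t
... | inj₂ (T , T-tr , ∣T∣≤) = inj₂ (T , T-tr , ≤-trans ∣T∣≤ (*-monoˡ-≤ r (n≤1+n t)))
... | inj₁ D@(E , E-edge , _) with extend⊎transversal D
...   | inj₁ D′   = inj₁ D′
...   | inj₂ E-tr =
  inj₂ (⋃ᶠ E , E-tr , ≤-trans (∣⋃ᶠ∣≤ E (λ i → UH (E i) (E-edge i))) (*-monoˡ-≤ r (n≤1+n t)))

centreless⇒cone-FreeFM : ∀ {r s} {u : Fin n} → ¬ ∃ (Centre F) → (∃[ e ] F e ≡ true) →
  FreeFM r (suc s) F (cone G u)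
centreless⇒cone-FreeFM {G = G} {r} {s} {u} ∄centre edge =
  ∄centre ∘ Contains-centred (cone-centre G u) edge , centre⇒Matching-free s r (cone-centre G u)

link-free⇒cone-FreeFM : ∀ {r s} {u : Fin n} {v : Fin k} → Centre F v → (∃[ e ] F e ≡ true) →
  FreeOf (link F v) G → FreeFM r (suc s) F (cone G u)
link-free⇒cone-FreeFM {G = G} {r} {s} {u} cF edge G-free =
  G-free ∘ cone-Contains⇒Contains-link {G = G} cF edge , centre⇒Matching-free s r (cone-centre G u)

-- Counting edges

numEdges-through : (H : Hypergraph (suc n)) (x : Fin (suc n)) →
  numEdges (λ f → lookup f x ∧ H f) ≡ ∑ₛ (λ f → 𝟙 (H (insertAt f x inside)))
numEdges-through {n} H x = begin
  numEdges (λ f → lookup f x ∧ H f)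
    ≡⟨ trans (numEdges≡∑ₛ (λ f → lookup f x ∧ H f)) (∑ₛ-insertAt x (λ f → 𝟙 (lookup f x ∧ H f))) ⟩
  ∑ₛ (λ f → 𝟙 (lookup (insertAt f x inside) x ∧ H (insertAt f x inside)))
    + ∑ₛ (λ f → 𝟙 (lookup (insertAt f x outside) x ∧ H (insertAt f x outside)))
    ≡⟨ cong₂ _+_ (∑ₛ-cong λ f → cong (λ b → 𝟙 (b ∧ H (insertAt f x inside))) (insertAt-lookup f x inside))
                 (∑ₛ-cong λ f → cong (λ b → 𝟙 (b ∧ H (insertAt f x outside))) (insertAt-lookup f x outside)) ⟩
  ∑ₛ (λ f → 𝟙 (H (insertAt f x inside))) + ∑ₛ {n} (λ _ → 0)
    ≡⟨ trans (cong (∑ₛ (λ f → 𝟙 (H (insertAt f x inside))) +_) (∑ₛ-zero n)) (+-identityʳ _) ⟩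
  ∑ₛ (λ f → 𝟙 (H (insertAt f x inside))) ∎
  where open ≡-Reasoning

numEdges-avoiding : (H : Hypergraph (suc n)) (x : Fin (suc n)) →
  numEdges (λ f → not (lookup f x) ∧ H f) ≡ ∑ₛ (λ f → 𝟙 (H (insertAt f x outside)))
numEdges-avoiding {n} H x = begin
  numEdges (λ f → not (lookup f x) ∧ H f)
    ≡⟨ trans (numEdges≡∑ₛ (λ f → not (lookup f x) ∧ H f)) (∑ₛ-insertAt x (λ f → 𝟙 (not (lookup f x) ∧ H f))) ⟩
  ∑ₛ (λ f → 𝟙 (not (lookup (insertAt f x inside) x) ∧ H (insertAt f x inside)))
    + ∑ₛ (λ f → 𝟙 (not (lookup (insertAt f x outside) x) ∧ H (insertAt f x outside)))
    ≡⟨ cong₂ _+_ (∑ₛ-cong λ f → cong (λ b → 𝟙 (not b ∧ H (insertAt f x inside))) (insertAt-lookup f x inside))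
                 (∑ₛ-cong λ f → cong (λ b → 𝟙 (not b ∧ H (insertAt f x outside))) (insertAt-lookup f x outside)) ⟩
  ∑ₛ {n} (λ _ → 0) + ∑ₛ (λ f → 𝟙 (H (insertAt f x outside)))
    ≡⟨ cong (_+ ∑ₛ (λ f → 𝟙 (H (insertAt f x outside)))) (∑ₛ-zero n) ⟩
  ∑ₛ (λ f → 𝟙 (H (insertAt f x outside))) ∎
  where open ≡-Reasoning

numEdges-through≡numEdges-link : (H : Hypergraph n) (x : Fin n) →
  numEdges (λ f → lookup f x ∧ H f) ≡ numEdges (link H x)
numEdges-through≡numEdges-link {suc n} H x = begin
  numEdges (λ f → lookup f x ∧ H f)
    ≡⟨ numEdges-through H x ⟩
  ∑ₛ (λ f → 𝟙 (H (insertAt f x inside)))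
    ≡⟨ ∑ₛ-cong (λ f → cong (𝟙 ∘ H) (sym (insertAt-outside∪⁅⁆ f x))) ⟩
  ∑ₛ (λ f → 𝟙 (H (insertAt f x outside ∪ ⁅ x ⁆)))
    ≡⟨ numEdges-avoiding (λ f → H (f ∪ ⁅ x ⁆)) x ⟨
  numEdges (link H x) ∎
  where open ≡-Reasoning

numEdges-cone : (G : Hypergraph n) (u : Fin n) →
  numEdges (cone G u) ≡ numEdges (λ f → not (lookup f u) ∧ G f)
numEdges-cone {suc n} G u = begin
  numEdges (cone G u)                                ≡⟨ numEdges-through (λ f → G (f - u)) u ⟩
  ∑ₛ (λ f → 𝟙 (G (insertAt f u inside - u)))         ≡⟨ ∑ₛ-cong (λ f → cong (𝟙 ∘ G) (insertAt-inside-u f)) ⟩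
  ∑ₛ (λ f → 𝟙 (G (insertAt f u outside)))            ≡⟨ numEdges-avoiding G u ⟨
  numEdges (λ f → not (lookup f u) ∧ G f)            ∎
  where
  open ≡-Reasoning
  insertAt-inside-u : ∀ f → insertAt f u inside - u ≡ insertAt f u outside
  insertAt-inside-u f = begin
    insertAt f u inside - u                  ≡⟨ cong (_- u) (insertAt-outside∪⁅⁆ f u) ⟨
    insertAt f u outside ∪ ⁅ u ⁆ - u         ≡⟨ p∪⁅x⁆-x≡p (lookup≡false⇒∉ (insertAt-lookup f u outside)) ⟩
    insertAt f u outside                     ∎

union-bound : (H : Hypergraph n) (T : Subset n) (c : Fin n → Subset n → Bool) {B : ℕ} →
  (∀ f → H f ≡ true → ∃[ z ] z ∈ T × c z f ≡ true) →
  (∀ x → x ∈ T → numEdges (λ f → c x f ∧ H f) ≤ B) →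
  numEdges H ≤ ∣ T ∣ * B
union-bound {n} H T c {B} covered bounded = begin
  numEdges H
    ≡⟨ numEdges≡∑ₛ H ⟩
  ∑ₛ (𝟙 ∘ H)
    ≤⟨ ∑ₛ-mono-≤ 𝟙∘H≤ ⟩
  ∑ₛ (λ f → ∑[ i < n ] (𝟙 (lookup T i) * 𝟙 (c i f ∧ H f)))
    ≡⟨ ∑ₛ-sum-comm (λ x f → 𝟙 (lookup T x) * 𝟙 (c x f ∧ H f)) ⟩
  ∑[ i < n ] ∑ₛ (λ f → 𝟙 (lookup T i) * 𝟙 (c i f ∧ H f))
    ≡⟨ sum-cong-≗ (λ i → trans (cong (𝟙 (lookup T i) *_) (numEdges≡∑ₛ (λ f → c i f ∧ H f)))
                               (*-distribˡ-∑ₛ (𝟙 (lookup T i)) (λ f → 𝟙 (c i f ∧ H f)))) ⟨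
  ∑[ i < n ] (𝟙 (lookup T i) * numEdges (λ f → c i f ∧ H f))
    ≤⟨ sum-mono-≤ weighted≤ ⟩
  ∑[ i < n ] (𝟙 (lookup T i) * B)
    ≡⟨ *-distribʳ-sum B (λ x → 𝟙 (lookup T x)) ⟨
  (∑[ i < n ] 𝟙 (lookup T i)) * B
    ≡⟨ cong (_* B) (sum-𝟙-lookup T) ⟩
  ∣ T ∣ * B ∎
  where
  open ≤-Reasoning
  𝟙∘H≤ : ∀ f → 𝟙 (H f) ≤ ∑[ i < n ] (𝟙 (lookup T i) * 𝟙 (c i f ∧ H f))
  𝟙∘H≤ f with H f in Hf
  ... | false = z≤n
  ... | true with covered f Hf
  ...   | x , x∈T , cxf =
    subst (_≤ sum g) (cong₂ (λ a b → 𝟙 a * 𝟙 (b ∧ true)) ([]=⇒lookup x∈T) cxf) (term≤sum g x)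
    where
    g : Fin n → ℕ
    g i = 𝟙 (lookup T i) * 𝟙 (c i f ∧ true)
  weighted≤ : ∀ x → 𝟙 (lookup T x) * numEdges (λ f → c x f ∧ H f) ≤ 𝟙 (lookup T x) * B
  weighted≤ x with lookup T x in x∈T
  ... | true  = *-monoʳ-≤ 1 (bounded x (lookup⇒[]= x T x∈T))
  ... | false = z≤n

numEdges≤-Matching-free : ∀ {r t B} → Uniform r H → ¬ Contains H (Matching t r) →
  (∀ x → numEdges (link H x) ≤ B) → numEdges H ≤ t * r * B
numEdges≤-Matching-free {H = H} {r} {t} {B} UH noM deg≤B with DisjointEdges⊎transversal UH t
... | inj₁ D = ⊥-elim (noM (DisjointEdges⇒Contains-Matching r UH D))
... | inj₂ (T , T-tr , ∣T∣≤) = begin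
  numEdges H       ≤⟨ union-bound H T (λ x f → lookup f x) covered bounded ⟩
  ∣ T ∣ * B        ≤⟨ *-monoˡ-≤ B ∣T∣≤ ⟩
  t * r * B        ∎
  where
  open ≤-Reasoning
  covered : ∀ f → H f ≡ true → ∃[ x ] x ∈ T × lookup f x ≡ true
  covered f Hf with x , x∈T , x∈f ← T-tr f Hf = x , x∈T , []=⇒lookup x∈f
  bounded : ∀ x → x ∈ T → numEdges (λ f → lookup f x ∧ H f) ≤ B
  bounded x _ = subst (_≤ B) (sym (numEdges-through≡numEdges-link H x)) (deg≤B x)

-- An edge f of a j-graph misses one of any j + 1 vertices x, and then f ∪ ⁅ x ⁆ is an edge of cone G x.
numEdges≤-cones : ∀ j {B} {G : Hypergraph n} → suc j ≤ n → Uniform j G →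
  (∀ x → numEdges (cone G x) ≤ B) → numEdges G ≤ suc j * B
numEdges≤-cones j {B} {G} j<n UG cone≤B with S , ∣S∣≡1+j ← subset-of-size j<n =
  subst (λ c → numEdges G ≤ c * B) ∣S∣≡1+j (union-bound G S (λ x f → not (lookup f x)) covered bounded)
  where
  covered : ∀ f → G f ≡ true → ∃[ x ] x ∈ S × not (lookup f x) ≡ true
  covered f Gf with x , x∈S , x∉f ← pigeonhole S f (subst₂ _<_ (sym (UG f Gf)) (sym ∣S∣≡1+j) ≤-refl) =
    x , x∈S , cong not (∉⇒lookup≡false x∉f)
  bounded : ∀ x → x ∈ S → numEdges (λ f → not (lookup f x) ∧ G f) ≤ B
  bounded x _ = subst (_≤ B) (numEdges-cone G x) (cone≤B x)

-- Subsets of a given size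

≡ᵇ-true⇒≡ : ∀ m n → (m ≡ᵇ n) ≡ true → m ≡ n
≡ᵇ-true⇒≡ m n eq = ≡ᵇ⇒≡ m n (Equivalence.from T-≡ eq)

≡⇒≡ᵇ-true : ∀ {m n} → m ≡ n → (m ≡ᵇ n) ≡ true
≡⇒≡ᵇ-true {m} {n} eq = Equivalence.to T-≡ (≡⇒≡ᵇ m n eq)

^-distrib-* : ∀ a b j → (a * b) ^ j ≡ a ^ j * b ^ j
^-distrib-* a b zero    = refl
^-distrib-* a b (suc j) = trans (cong (a * b *_) (^-distrib-* a b j)) (*-interchange a b _ _)

_choose_ : ℕ → ℕ → ℕ
n choose j = ∑ₛ {n} (λ f → 𝟙 (∣ f ∣ ≡ᵇ j))

choose-zero : ∀ n → n choose 0 ≡ 1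
choose-zero zero    = refl
choose-zero (suc n) = cong₂ _+_ (∑ₛ-zero n) (choose-zero n)

choose-one : ∀ n → n choose 1 ≡ n
choose-one zero    = refl
choose-one (suc n) = cong₂ _+_ (choose-zero n) (choose-one n)

choose≤^ : ∀ n j → n choose j ≤ n ^ j
choose≤^ n       zero    = ≤-reflexive (choose-zero n)
choose≤^ zero    (suc j) = z≤n
choose≤^ (suc n) (suc j) = +-mono-≤
  (≤-trans (choose≤^ n j) (^-monoˡ-≤ j (n≤1+n n)))
  (≤-trans (choose≤^ n (suc j)) (*-monoʳ-≤ n (^-monoˡ-≤ j (n≤1+n n))))

choose-vandermonde : ∀ p m i j → (p choose i) * (m choose j) ≤ (p + m) choose (i + j)
choose-vandermonde p m i j = begin
  (p choose i) * (m choose j)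
    ≡⟨ *-distribʳ-∑ₛ {p} (m choose j) (λ a → 𝟙 (∣ a ∣ ≡ᵇ i)) ⟩
  ∑ₛ {p} (λ a → 𝟙 (∣ a ∣ ≡ᵇ i) * (m choose j))
    ≡⟨ ∑ₛ-cong {p} (λ a → *-distribˡ-∑ₛ {m} (𝟙 (∣ a ∣ ≡ᵇ i)) (λ b → 𝟙 (∣ b ∣ ≡ᵇ j))) ⟩
  ∑ₛ {p} (λ a → ∑ₛ {m} (λ b → 𝟙 (∣ a ∣ ≡ᵇ i) * 𝟙 (∣ b ∣ ≡ᵇ j)))
    ≤⟨ ∑ₛ-mono-≤ {p} (λ a → ∑ₛ-mono-≤ {m} (λ b → 𝟙-mono₂ {∣ a ∣ ≡ᵇ i} {∣ b ∣ ≡ᵇ j} λ ∣a∣≡i ∣b∣≡j →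
         ≡⇒≡ᵇ-true (trans (∣p++q∣≡∣p∣+∣q∣ a b)
                          (cong₂ _+_ (≡ᵇ-true⇒≡ ∣ a ∣ i ∣a∣≡i) (≡ᵇ-true⇒≡ ∣ b ∣ j ∣b∣≡j))))) ⟩
  ∑ₛ {p} (λ a → ∑ₛ {m} (λ b → 𝟙 (∣ a ++ b ∣ ≡ᵇ i + j)))
    ≡⟨ ∑ₛ-++ p (λ f → 𝟙 (∣ f ∣ ≡ᵇ i + j)) ⟨
  (p + m) choose (i + j) ∎
  where open ≤-Reasoning

choose-monoˡ-≤ : ∀ {m n} j → m ≤ n → m choose j ≤ n choose j
choose-monoˡ-≤ {m} {n} j m≤n = begin
  m choose j                          ≡⟨ +-identityʳ _ ⟨
  1 * (m choose j)                    ≡⟨ cong (_* (m choose j)) (choose-zero (n ∸ m)) ⟨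
  ((n ∸ m) choose 0) * (m choose j)   ≤⟨ choose-vandermonde (n ∸ m) m 0 j ⟩
  (n ∸ m + m) choose j                ≡⟨ cong (_choose j) (m∸n+n≡m m≤n) ⟩
  n choose j                          ∎
  where open ≤-Reasoning

^≤choose : ∀ j q → q ^ j ≤ (j * q) choose j
^≤choose zero    q = ≤-refl
^≤choose (suc j) q = begin
  q * q ^ j                          ≡⟨ cong (_* q ^ j) (choose-one q) ⟨
  (q choose 1) * q ^ j               ≤⟨ *-monoʳ-≤ (q choose 1) (^≤choose j q) ⟩
  (q choose 1) * ((j * q) choose j)  ≤⟨ choose-vandermonde q (j * q) 1 j ⟩
  (suc j * q) choose (suc j)         ∎
  where open ≤-Reasoning

-- With q = ⌊n / j⌋ ≥ 1, one vertex from each of j disjoint q-blocks gives q^j of the j-sets, and n < 2jq.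
^≤choose-lower : ∀ {j n} → 1 ≤ j → j ≤ n → suc n ^ j ≤ (j + j) ^ j * (n choose j)
^≤choose-lower {j} {n} 1≤j j≤n = begin
  suc n ^ j                          ≤⟨ ^-monoˡ-≤ j 1+n≤2jq ⟩
  ((j + j) * q) ^ j                  ≡⟨ ^-distrib-* (j + j) q j ⟩
  (j + j) ^ j * q ^ j                ≤⟨ *-monoʳ-≤ ((j + j) ^ j) (^≤choose j q) ⟩
  (j + j) ^ j * ((j * q) choose j)   ≤⟨ *-monoʳ-≤ ((j + j) ^ j) (choose-monoˡ-≤ j jq≤n) ⟩
  (j + j) ^ j * (n choose j)         ∎
  where
  open ≤-Reasoning
  instance _ = >-nonZero 1≤j
  q : ℕ
  q = n / j
  1≤q : 1 ≤ q
  1≤q = m≥n⇒m/n>0 j≤n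
  jq≤n : j * q ≤ n
  jq≤n = subst (_≤ n) (*-comm q j) (m/n*n≤m n j)
  1+n≤2jq : suc n ≤ (j + j) * q
  1+n≤2jq = begin
    suc n               ≡⟨ cong suc (m≡m%n+[m/n]*n n j) ⟩
    suc (n % j) + q * j ≤⟨ +-monoˡ-≤ (q * j) (m%n<n n j) ⟩
    j + q * j           ≤⟨ +-monoˡ-≤ (q * j) (m≤n*m j q {{>-nonZero 1≤q}}) ⟩
    q * j + q * j       ≡⟨ cong₂ _+_ (*-comm q j) (*-comm q j) ⟩
    j * q + j * q       ≡⟨ *-distribʳ-+ q j j ⟨
    (j + j) * q         ∎

Complete : ℕ → Hypergraph n
Complete j f = ∣ f ∣ ≡ᵇ j

Complete-uniform : ∀ j → Uniform j (Complete {n} j)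
Complete-uniform j f = ≡ᵇ-true⇒≡ ∣ f ∣ j

numEdges≤choose : ∀ j (H : Hypergraph n) → Uniform j H → numEdges H ≤ n choose j
numEdges≤choose {n} j H UH = begin
  numEdges H   ≡⟨ numEdges≡∑ₛ H ⟩
  ∑ₛ (𝟙 ∘ H)   ≤⟨ ∑ₛ-mono-≤ (λ f → 𝟙-mono (≡⇒≡ᵇ-true ∘ UH f)) ⟩
  n choose j   ∎
  where open ≤-Reasoning

^≤numEdges-cone-Complete : ∀ {j n} → 1 ≤ j → j ≤ n →
  suc n ^ j ≤ (j + j) ^ j * numEdges (cone (Complete {suc n} j) zero)
^≤numEdges-cone-Complete {j} {n} 1≤j j≤n = subst (λ c → suc n ^ j ≤ (j + j) ^ j * c)
  (sym (trans (numEdges-cone (Complete {suc n} j) zero) (numEdges-avoiding (Complete {suc n} j) zero)))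
  (^≤choose-lower 1≤j j≤n)

proposition1p5 : (r s : ℕ) → 2 ≤ r → 1 ≤ s →
    (k : ℕ) (F : Hypergraph k) → Uniform r F → (∃[ e ] F e ≡ true) →
    ((¬ (∃[ v ] ((e : Subset k) → F e ≡ true → lookup e v ≡ true))) →
      ∃[ a ] ∃[ C ] ∃[ n₀ ] ((n : ℕ) → n₀ ≤ n → (m : ℕ) → IsEx r n (FreeFM r s F) m →
        (n ^ (r ∸ 1) ≤ a * m) × (m ≤ C * n ^ (r ∸ 1))))
    × ((v : Fin k) → ((e : Subset k) → F e ≡ true → lookup e v ≡ true) →
      ∃[ a ] ∃[ C ] ∃[ n₀ ] ((n : ℕ) → n₀ ≤ n → (m₁ m₂ : ℕ) →
        IsEx r n (FreeFM r s F) m₁ → IsEx (r ∸ 1) n (FreeOf (link F v)) m₂ →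
        (m₂ ≤ a * m₁) × (m₁ ≤ C * m₂)))
proposition1p5 (suc zero) _ (s≤s ()) _ _ _ _ _
proposition1p5 r@(suc j@(suc _)) s@(suc _) _ _ k F _ edge = no-centre , centre
  where
  no-centre : ¬ ∃ (Centre F) → _
  no-centre ∄centre = (j + j) ^ j , suc s * r , r , bounds
    where
    bounds : ∀ n → r ≤ n → ∀ m → IsEx r n (FreeFM r s F) m →
      (n ^ j ≤ (j + j) ^ j * m) × (m ≤ suc s * r * n ^ j)
    bounds (suc n) (s≤s j≤n) _ ((H , UH , (_ , noM) , refl) , maximal) =
        ≤-trans (^≤numEdges-cone-Complete (s≤s z≤n) j≤n) (*-monoʳ-≤ ((j + j) ^ j)
          (maximal _ (cone-uniform j (Complete-uniform j))
                     (centreless⇒cone-FreeFM {G = Complete j} {r = r} ∄centre edge)))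
      , numEdges≤-Matching-free UH noM λ x →
          ≤-trans (numEdges≤choose j (link H x) (link-uniform j UH)) (choose≤^ (suc n) j)
  centre : (v : Fin k) → Centre F v → _
  centre v cF = r , suc s * r , r , bounds
    where
    bounds : ∀ n → r ≤ n → ∀ m₁ m₂ → IsEx r n (FreeFM r s F) m₁ → IsEx j n (FreeOf (link F v)) m₂ →
      (m₂ ≤ r * m₁) × (m₁ ≤ suc s * r * m₂)
    bounds n r≤n _ _ ((H , UH , (noF , noM) , refl) , maximal₁) ((G , UG , G-free , refl) , maximal₂) =
        numEdges≤-cones j r≤n UG (λ x → maximal₁ (cone G x) (cone-uniform j UG)
                                                  (link-free⇒cone-FreeFM {G = G} {r = r} cF edge G-free))
      , numEdges≤-Matching-free UH noM (λ x →
          maximal₂ (link H x) (link-uniform j UH) (noF ∘ link-lift {H = H} cF))
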